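{- Let $A$ be a real $n\times n$ matrix each of whose rows is covered by $\mathcal{F}+\mathcal{F}$. Then $|\det A|\le 2^n$. Moreover, if in addition $m\ge0$ of the rows of $A$ are covered by $\mathcal{F}$, then $|\det A|\le 2^{n-m}$.
   Context: For $\vec x,\vec y\in\mathbb{R}^n$, write $\vec x\preceq\vec y$ if for every $i$, $x_iy_i\ge0$ and $|x_i|\le|y_i|$; a vector $\vec x$ is covered by a set $S\subseteq\mathbb{R}^n$ if $\vec x\preceq\vec y$ for some $\vec y\in S$. Let $\vec e_i$ be the $i$-th standard basis vector, and for $i\ne j$ let $\vec p_{(i,j)}=\vec e_j-\vec e_i$. Let $\mathcal{F}=\{\vec p_{(i,j)}: i\ne j\}\cup\{\vec e_i\}_{i=1}^n\cup\{ -\vec e_i\}_{i=1}^n$ and $\mathcal{F}+\mathcal{F}=\{\vec f+\vec g:\vec f,\vec g\in\mathcal{F}\}$. -}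

module Defs where

open import Level using (0ℓ)
open import Data.Nat using (ℕ; zero; suc)
open import Data.Fin using (Fin; zero; suc; toℕ; punchIn; _≟_)
open import Data.Product using (Σ; ∃; _×_; _,_)
open import Data.Sum using (_⊎_; inj₁; inj₂)
open import Relation.Nullary using (¬_; yes; no)
open import Relation.Binary.PropositionalEquality using (_≡_)
open import Algebra.Structures using (IsCommutativeRing)
open import Relation.Binary.Structures using (IsTotalOrder)

-- The real numbers, axiomatised as a complete ordered field
-- (any two models are isomorphic, so quantifying over all models
-- is the same as speaking about ℝ).
record RealField : Set₁ where
  infixl 6 _+_
  infixl 7 _*_
  infix 4 _≤_
  field
    Carrier : Set
    _+_ _*_ : Carrier → Carrier → Carrier
    -_ : Carrier → Carrier
    0# 1# : Carrier
    _≤_ : Carrier → Carrier → Set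
    isCommutativeRing : IsCommutativeRing _≡_ _+_ _*_ -_ 0# 1#
    0≢1 : ¬ (0# ≡ 1#)
    inverse : ∀ x → ¬ (x ≡ 0#) → ∃ λ y → x * y ≡ 1#
    isTotalOrder : IsTotalOrder _≡_ _≤_
    +-mono-≤ : ∀ {x y} z → x ≤ y → x + z ≤ y + z
    *-nonneg : ∀ {x y} → 0# ≤ x → 0# ≤ y → 0# ≤ x * y
    completeness : (P : Carrier → Set) → (∃ λ x → P x) →
                   (∃ λ b → ∀ x → P x → x ≤ b) →
                   ∃ λ s → (∀ x → P x → x ≤ s) ×
                           (∀ b → (∀ x → P x → x ≤ b) → s ≤ b)

module _ (R : RealField) where
  open RealField R

  _-_ : Carrier → Carrier → Carrier
  x - y = x + (- y)

  ∣_∣ : Carrier → Carrier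
  ∣ x ∣ with IsTotalOrder.total isTotalOrder 0# x
  ... | inj₁ _ = x
  ... | inj₂ _ = - x

  pow2 : ℕ → Carrier
  pow2 zero = 1#
  pow2 (suc k) = (1# + 1#) * pow2 k

  Vector : ℕ → Set
  Vector n = Fin n → Carrier

  -- n × n matrices; A i is the i-th row, A i j the (i,j) entry
  Matrix : ℕ → Set
  Matrix n = Fin n → Fin n → Carrier

  sumFin : ∀ {n} → (Fin n → Carrier) → Carrier
  sumFin {zero} f = 0#
  sumFin {suc n} f = f zero + sumFin (λ i → f (suc i))

  sign : ℕ → Carrier
  sign zero = 1#
  sign (suc k) = - sign k

  minor : ∀ {n} → Matrix (suc n) → Fin (suc n) → Matrix n
  minor A j r c = A (suc r) (punchIn j c)

  det : ∀ {n} → Matrix n → Carrier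
  det {zero} A = 1#
  det {suc n} A = sumFin (λ j → sign (toℕ j) * (A zero j * det (minor A j)))

  e : ∀ {n} → Fin n → Vector n
  e i k with k ≟ i
  ... | yes _ = 1#
  ... | no _ = 0#

  p : ∀ {n} → Fin n → Fin n → Vector n
  p i j k = e j k - e i k

  -- names of the elements of 𝓕
  data FName (n : ℕ) : Set where
    pName : (i j : Fin n) → ¬ (i ≡ j) → FName n
    eName : Fin n → FName n
    negEName : Fin n → FName n

  ⟦_⟧ : ∀ {n} → FName n → Vector n
  ⟦ pName i j _ ⟧ = p i j
  ⟦ eName i ⟧ = e i
  ⟦ negEName i ⟧ = λ k → - e i k

  _⪯_ : ∀ {n} → Vector n → Vector n → Set
  x ⪯ y = ∀ i → (0# ≤ x i * y i) × (∣ x i ∣ ≤ ∣ y i ∣)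

  CoveredByF : ∀ {n} → Vector n → Set
  CoveredByF x = ∃ λ f → x ⪯ ⟦ f ⟧

  CoveredByFF : ∀ {n} → Vector n → Set
  CoveredByFF x = ∃ λ f → ∃ λ g → x ⪯ (λ k → ⟦ f ⟧ k + ⟦ g ⟧ k)

{-# OPTIONS --safe #-}
-- Say that a row v has mass at most c if both Σ v_k⁺ ≤ c and Σ v_k⁻ ≤ c. If row r of A has mass
-- at most c_r for every r, then |det A| ≤ ∏ c_r. By induction: expanding along the first row a,
-- det A = Σ a_l C_l, where each cofactor C_l lies in [−M, M] for M = ∏_{r>0} c_r, and so does
-- each difference C_j − C_k, which up to sign is the determinant of the remaining rows with
-- columns j and k merged (merging columns does not increase the mass of a row). Hence
-- Σ a_l C_l ≤ (Σ a_l⁺) max C + (Σ a_l⁻) max (−C) ≤ c_0 (max C + max (−C)) ≤ c_0 M.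
-- A row covered by 𝓕 has mass at most 1 and one covered by 𝓕 + 𝓕 mass at most 2, since every
-- entry of the covering vector is 0 or at least 1 in absolute value; so the m rows covered by 𝓕
-- contribute a factor 1 and the other n − m rows a factor 2.

module Submission where

open import Defs
open import Data.Nat using (ℕ; _∸_; zero; suc; s≤s)
import Data.Nat as ℕ
import Data.Nat.Properties as ℕ
open import Data.Fin using (Fin; zero; suc; toℕ; punchIn; punchOut; inject₁; _≟_)
import Data.Fin.Properties as Fin
open import Data.Vec.Functional using (foldr)
open import Function using (_∘_)
open import Data.Product using (_×_; _,_; proj₁; proj₂; ∃)
open import Data.Sum using (_⊎_; inj₁; inj₂; [_,_]′)
open import Data.Empty using (⊥-elim)
open import Relation.Nullary using (yes; no; Dec)
open import Function.Definitions using (Injective)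
open import Relation.Binary.PropositionalEquality
open import Relation.Binary.Bundles using (TotalOrder)
open import Relation.Binary.Structures using (IsTotalOrder)
open import Relation.Binary.Definitions using (tri<; tri≈; tri>)
open import Algebra.Bundles using (CommutativeRing)
import Relation.Binary.Reasoning.PartialOrder

module DeterminantBound (R : RealField) where
  open RealField R hiding (Carrier) renaming (+-mono-≤ to +-monoˡ-≤)
  open RealField R using () renaming (Carrier to K)

  commutativeRing : CommutativeRing _ _
  commutativeRing = record { isCommutativeRing = isCommutativeRing }

  totalOrder : TotalOrder _ _ _
  totalOrder = record { isTotalOrder = isTotalOrder }

  open CommutativeRing commutativeRing
    using (+-comm; +-assoc; *-comm; *-assoc; distribˡ; distribʳ; +-identityˡ; +-identityʳ;
           *-identityˡ; *-identityʳ; -‿inverseˡ; -‿inverseʳ; ring; semiring)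
  open import Algebra.Properties.Ring ring
    using (-‿distribˡ-*; -‿distribʳ-*; -‿involutive; -0#≈0#; -‿+-comm; ⁻¹-anti-homo‿-)
  open import Algebra.Properties.Semiring.Sum semiring
    using (sum; sum-cong-≗; sum-remove; sum-replicate-zero; ∑-distrib-+; *-distribʳ-sum)
  open import Algebra.Construct.NaturalChoice.Max totalOrder
    using (_⊔_; x≤x⊔y; x≤y⊔x; ⊔-sel; ⊔-lub; x≤y⇒x⊔y≈y; x≤y⇒y⊔x≈y)
  open IsTotalOrder isTotalOrder
    using (total; antisym; reflexive) renaming (refl to ≤-refl; trans to ≤-trans)
  module ≤-Reasoning = Relation.Binary.Reasoning.PartialOrder (TotalOrder.poset totalOrder)

  -- Ordered-ring arithmetic

  +-monoʳ-≤ : ∀ {x y} z → x ≤ y → z + x ≤ z + y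
  +-monoʳ-≤ {x} {y} z x≤y = subst₂ _≤_ (+-comm x z) (+-comm y z) (+-monoˡ-≤ z x≤y)

  +-mono-≤ : ∀ {a b c d} → a ≤ b → c ≤ d → a + c ≤ b + d
  +-mono-≤ {b = b} {c} a≤b c≤d = ≤-trans (+-monoˡ-≤ c a≤b) (+-monoʳ-≤ b c≤d)

  x-0≡x : ∀ x → x + - 0# ≡ x
  x-0≡x x = trans (cong (x +_) -0#≈0#) (+-identityʳ x)

  x-y+y≡x : ∀ x y → (x + - y) + y ≡ x
  x-y+y≡x x y = begin
    (x + - y) + y ≡⟨ +-assoc x (- y) y ⟩
    x + (- y + y) ≡⟨ cong (x +_) (-‿inverseˡ y) ⟩
    x + 0#        ≡⟨ +-identityʳ x ⟩
    x             ∎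
    where open ≡-Reasoning

  -x*-y≡x*y : ∀ x y → - x * - y ≡ x * y
  -x*-y≡x*y x y = begin
    - x * - y     ≡⟨ sym (-‿distribˡ-* x (- y)) ⟩
    - (x * - y)   ≡⟨ cong -_ (sym (-‿distribʳ-* x y)) ⟩
    - (- (x * y)) ≡⟨ -‿involutive _ ⟩
    x * y         ∎
    where open ≡-Reasoning

  x≤y⇒0≤y-x : ∀ {x y} → x ≤ y → 0# ≤ y + - x
  x≤y⇒0≤y-x {x} x≤y = subst (_≤ _) (-‿inverseʳ x) (+-monoˡ-≤ (- x) x≤y)

  0≤y-x⇒x≤y : ∀ {x y} → 0# ≤ y + - x → x ≤ y
  0≤y-x⇒x≤y {x} {y} 0≤y-x = subst₂ _≤_ (+-identityˡ x) (x-y+y≡x y x) (+-monoˡ-≤ x 0≤y-x)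

  -‿antimono-≤ : ∀ {x y} → x ≤ y → - y ≤ - x
  -‿antimono-≤ {x} {y} x≤y = 0≤y-x⇒x≤y (subst (0# ≤_) y-x≡-x--y (x≤y⇒0≤y-x x≤y))
    where
    y-x≡-x--y : y + - x ≡ - x + - (- y)
    y-x≡-x--y = trans (+-comm y (- x)) (cong (- x +_) (sym (-‿involutive y)))

  x≤0⇒0≤-x : ∀ {x} → x ≤ 0# → 0# ≤ - x
  x≤0⇒0≤-x x≤0 = subst (_≤ _) -0#≈0# (-‿antimono-≤ x≤0)

  0≤x⇒-x≤0 : ∀ {x} → 0# ≤ x → - x ≤ 0#
  0≤x⇒-x≤0 0≤x = subst (_ ≤_) -0#≈0# (-‿antimono-≤ 0≤x)

  0≤-x⇒x≤0 : ∀ {x} → 0# ≤ - x → x ≤ 0#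
  0≤-x⇒x≤0 {x} 0≤-x = subst (_≤ 0#) (-‿involutive x) (0≤x⇒-x≤0 0≤-x)

  0≤1 : 0# ≤ 1#
  0≤1 with total 0# 1#
  ... | inj₁ 0≤1 = 0≤1
  ... | inj₂ 1≤0 = subst (0# ≤_) (trans (-x*-y≡x*y 1# 1#) (*-identityˡ 1#)) (*-nonneg 0≤-1 0≤-1)
    where
    0≤-1 : 0# ≤ - 1#
    0≤-1 = x≤0⇒0≤-x 1≤0

  -1≤0 : - 1# ≤ 0#
  -1≤0 = 0≤x⇒-x≤0 0≤1

  1≤2 : 1# ≤ 1# + 1#
  1≤2 = subst (_≤ 1# + 1#) (+-identityʳ 1#) (+-monoʳ-≤ 1# 0≤1)

  *-monoʳ-≤ : ∀ {x y z} → 0# ≤ x → y ≤ z → x * y ≤ x * z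
  *-monoʳ-≤ {x} {y} {z} 0≤x y≤z = 0≤y-x⇒x≤y (subst (0# ≤_) x[z-y]≡xz-xy (*-nonneg 0≤x (x≤y⇒0≤y-x y≤z)))
    where
    x[z-y]≡xz-xy : x * (z + - y) ≡ x * z + - (x * y)
    x[z-y]≡xz-xy = trans (distribˡ x z (- y)) (cong (x * z +_) (sym (-‿distribʳ-* x y)))

  *-monoˡ-≤ : ∀ {x y z} → 0# ≤ x → y ≤ z → y * x ≤ z * x
  *-monoˡ-≤ {x} {y} {z} 0≤x y≤z = subst₂ _≤_ (*-comm x y) (*-comm x z) (*-monoʳ-≤ 0≤x y≤z)

  *-mono-≤ : ∀ {x a y b} → 0# ≤ x → x ≤ a → 0# ≤ y → y ≤ b → x * y ≤ a * b
  *-mono-≤ 0≤x x≤a 0≤y y≤b = ≤-trans (*-monoʳ-≤ 0≤x y≤b) (*-monoˡ-≤ (≤-trans 0≤y y≤b) x≤a)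

  infix 4 _∈±_
  _∈±_ : K → K → Set
  x ∈± M = x ≤ M × - x ≤ M

  0∈± : ∀ {M} → 0# ≤ M → 0# ∈± M
  0∈± 0≤M = 0≤M , subst (_≤ _) (sym -0#≈0#) 0≤M

  ∈±-neg : ∀ {x M} → x ∈± M → - x ∈± M
  ∈±-neg {x} (x≤M , -x≤M) = -x≤M , subst (_≤ _) (sym (-‿involutive x)) x≤M

  ∈±-sign : ∀ k {x M} → x ∈± M → sign R k * x ∈± M
  ∈±-sign zero    {x} x∈±M = subst (_∈± _) (sym (*-identityˡ x)) x∈±M
  ∈±-sign (suc k) {x} x∈±M = subst (_∈± _) (-‿distribˡ-* (sign R k) x) (∈±-neg (∈±-sign k x∈±M))

  ∈±⇒∣∣≤ : ∀ {x M} → x ∈± M → ∣_∣ R x ≤ M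
  ∈±⇒∣∣≤ {x} (x≤M , -x≤M) with total 0# x
  ... | inj₁ _ = x≤M
  ... | inj₂ _ = -x≤M

  ∣∣-nonneg : ∀ {x} → 0# ≤ x → ∣_∣ R x ≡ x
  ∣∣-nonneg {x} 0≤x with total 0# x
  ... | inj₁ _   = refl
  ... | inj₂ x≤0 = trans (cong -_ x≡0) (trans -0#≈0# (sym x≡0))
    where
    x≡0 : x ≡ 0#
    x≡0 = antisym x≤0 0≤x

  ∣∣-nonpos : ∀ {x} → x ≤ 0# → ∣_∣ R x ≡ - x
  ∣∣-nonpos {x} x≤0 with total 0# x
  ... | inj₁ 0≤x = trans x≡0 (sym (trans (cong -_ x≡0) -0#≈0#))
    where
    x≡0 : x ≡ 0#
    x≡0 = antisym x≤0 0≤x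
  ... | inj₂ _   = refl

  ∣-x∣≡∣x∣ : ∀ x → ∣_∣ R (- x) ≡ ∣_∣ R x
  ∣-x∣≡∣x∣ x = [ (λ 0≤x → trans (∣∣-nonpos (0≤x⇒-x≤0 0≤x)) (trans (-‿involutive x) (sym (∣∣-nonneg 0≤x))))
              , (λ x≤0 → trans (∣∣-nonneg (x≤0⇒0≤-x x≤0)) (sym (∣∣-nonpos x≤0)))
              ]′ (total 0# x)

  infix 30 _⁺ _⁻
  _⁺ _⁻ : K → K
  x ⁺ = x ⊔ 0#
  x ⁻ = (- x) ⁺

  ⁺-nonneg : ∀ x → 0# ≤ x ⁺
  ⁺-nonneg x = x≤y⊔x x 0#

  ⁻-nonneg : ∀ x → 0# ≤ x ⁻
  ⁻-nonneg x = ⁺-nonneg (- x)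

  x≤x⁺ : ∀ x → x ≤ x ⁺
  x≤x⁺ x = x≤x⊔y x 0#

  ⁺-nonpos : ∀ {x} → x ≤ 0# → x ⁺ ≡ 0#
  ⁺-nonpos = x≤y⇒x⊔y≈y

  ⁺-nonneg-id : ∀ {x} → 0# ≤ x → x ⁺ ≡ x
  ⁺-nonneg-id = x≤y⇒y⊔x≈y

  ⁺≤∣∣ : ∀ x → x ⁺ ≤ ∣_∣ R x
  ⁺≤∣∣ x = [ (λ 0≤x → reflexive (trans (⁺-nonneg-id 0≤x) (sym (∣∣-nonneg 0≤x))))
           , (λ x≤0 → subst₂ _≤_ (sym (⁺-nonpos x≤0)) (sym (∣∣-nonpos x≤0)) (x≤0⇒0≤-x x≤0))
           ]′ (total 0# x)

  ⁺-subadditive : ∀ x y → (x + y) ⁺ ≤ x ⁺ + y ⁺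
  ⁺-subadditive x y = ⊔-lub (+-mono-≤ (x≤x⁺ x) (x≤x⁺ y))
    (subst (_≤ x ⁺ + y ⁺) (+-identityˡ 0#) (+-mono-≤ (⁺-nonneg x) (⁺-nonneg y)))

  ⁻-subadditive : ∀ x y → (x + y) ⁻ ≤ x ⁻ + y ⁻
  ⁻-subadditive x y = subst (λ z → z ⁺ ≤ x ⁻ + y ⁻) (-‿+-comm x y) (⁺-subadditive (- x) (- y))

  ⁺-⁻-split : ∀ x → x ⁺ + - x ⁻ ≡ x
  ⁺-⁻-split x = [ nonneg , nonpos ]′ (total 0# x)
    where
    open ≡-Reasoning
    nonneg : 0# ≤ x → x ⁺ + - x ⁻ ≡ x
    nonneg 0≤x = begin
      x ⁺ + - x ⁻     ≡⟨ cong₂ (λ a b → a + - b) (⁺-nonneg-id 0≤x) (⁺-nonpos (0≤x⇒-x≤0 0≤x)) ⟩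
      x + - 0#        ≡⟨ cong (x +_) -0#≈0# ⟩
      x + 0#          ≡⟨ +-identityʳ x ⟩
      x               ∎
    nonpos : x ≤ 0# → x ⁺ + - x ⁻ ≡ x
    nonpos x≤0 = begin
      x ⁺ + - x ⁻     ≡⟨ cong₂ (λ a b → a + - b) (⁺-nonpos x≤0) (⁺-nonneg-id (x≤0⇒0≤-x x≤0)) ⟩
      0# + - (- x)    ≡⟨ +-identityˡ _ ⟩
      - (- x)         ≡⟨ -‿involutive x ⟩
      x               ∎

  *-split : ∀ x y → x * y ≡ x ⁺ * y + x ⁻ * (- y)
  *-split x y = begin
    x * y                   ≡⟨ cong (_* y) (sym (⁺-⁻-split x)) ⟩
    (x ⁺ + - x ⁻) * y       ≡⟨ distribʳ y (x ⁺) (- x ⁻) ⟩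
    x ⁺ * y + - x ⁻ * y     ≡⟨ cong (x ⁺ * y +_) (trans (sym (-‿distribˡ-* (x ⁻) y)) (-‿distribʳ-* (x ⁻) y)) ⟩
    x ⁺ * y + x ⁻ * (- y)   ∎
    where open ≡-Reasoning

  sumFin≡sum : ∀ {n} (f : Vector R n) → sumFin R f ≡ sum f
  sumFin≡sum {zero}  f = refl
  sumFin≡sum {suc n} f = cong (f zero +_) (sumFin≡sum (f ∘ suc))

  sum-neg : ∀ {n} (f : Vector R n) → sum (λ i → - f i) ≡ - sum f
  sum-neg {zero}  f = sym -0#≈0#
  sum-neg {suc n} f = trans (cong (- f zero +_) (sum-neg (f ∘ suc))) (-‿+-comm _ _)

  sum-mono-≤ : ∀ {n} {f g : Vector R n} → (∀ i → f i ≤ g i) → sum f ≤ sum g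
  sum-mono-≤ {zero}  f≤g = ≤-refl
  sum-mono-≤ {suc n} f≤g = +-mono-≤ (f≤g zero) (sum-mono-≤ (f≤g ∘ suc))

  sum-nonneg : ∀ {n} {f : Vector R n} → (∀ i → 0# ≤ f i) → 0# ≤ sum f
  sum-nonneg {zero}  0≤f = ≤-refl
  sum-nonneg {suc n} {f} 0≤f = subst (_≤ sum f) (+-identityˡ 0#) (+-mono-≤ (0≤f zero) (sum-nonneg (0≤f ∘ suc)))

  sum-single : ∀ {n} (f : Vector R (suc n)) l → (∀ d → f (punchIn l d) ≡ 0#) → sum f ≡ f l
  sum-single {n} f l f≡0 = begin
    sum f                       ≡⟨ sum-remove f ⟩
    f l + sum (f ∘ punchIn l)   ≡⟨ cong (f l +_) (trans (sum-cong-≗ f≡0) (sum-replicate-zero n)) ⟩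
    f l + 0#                    ≡⟨ +-identityʳ (f l) ⟩
    f l                         ∎
    where open ≡-Reasoning

  ∏ : ∀ {n} → Vector R n → K
  ∏ = foldr _*_ 1#

  ∏-nonneg : ∀ {n} {f : Vector R n} → (∀ i → 0# ≤ f i) → 0# ≤ ∏ f
  ∏-nonneg {zero}  0≤f = 0≤1
  ∏-nonneg {suc n} 0≤f = *-nonneg (0≤f zero) (∏-nonneg (0≤f ∘ suc))

  -- Column operations on determinants

  Rows : ℕ → ℕ → Set
  Rows n m = Fin n → Vector R m

  infixl 8 _∘cols_
  _∘cols_ : ∀ {n m m′} → Rows n m → (Fin m′ → Fin m) → Rows n m′
  (A ∘cols σ) r c = A r (σ c)

  det-suc : ∀ {n} (A : Matrix R (suc n)) →
            det R A ≡ sum (λ j → sign R (toℕ j) * (A zero j * det R (minor R A j)))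
  det-suc A = sumFin≡sum (λ j → sign R (toℕ j) * (A zero j * det R (minor R A j)))

  det-cong : ∀ {n} {A B : Matrix R n} → (∀ r c → A r c ≡ B r c) → det R A ≡ det R B
  det-cong {zero}          A≡B = refl
  det-cong {suc n} {A} {B} A≡B = trans (det-suc A) (trans (sum-cong-≗ cong-term) (sym (det-suc B)))
    where
    cong-term : ∀ j → sign R (toℕ j) * (A zero j * det R (minor R A j))
                    ≡ sign R (toℕ j) * (B zero j * det R (minor R B j))
    cong-term j = cong₂ (λ a d → sign R (toℕ j) * (a * d))
      (A≡B zero j) (det-cong (λ r c → A≡B (suc r) (punchIn j c)))

  det-cong-cols : ∀ {n m} (A : Rows n m) {σ τ : Fin n → Fin m} → (∀ c → σ c ≡ τ c) →
                  det R (A ∘cols σ) ≡ det R (A ∘cols τ)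
  det-cong-cols A σ≡τ = det-cong (λ r c → cong (A r) (σ≡τ c))

  cofactor : ∀ {n} → Rows n (suc n) → Fin (suc n) → K
  cofactor A l = sign R (toℕ l) * det R (A ∘cols punchIn l)

  det-expand : ∀ {n} (A : Matrix R (suc n)) → det R A ≡ sum (λ l → A zero l * cofactor (A ∘ suc) l)
  det-expand A = trans (det-suc A) (sum-cong-≗ λ l → x*[y*z]≡y*[x*z] (sign R (toℕ l)) (A zero l) (det R (minor R A l)))
    where
    x*[y*z]≡y*[x*z] : ∀ x y z → x * (y * z) ≡ y * (x * z)
    x*[y*z]≡y*[x*z] x y z = trans (sym (*-assoc x y z)) (trans (cong (_* z) (*-comm x y)) (*-assoc y x z))

  adjacentSwap : ∀ {k} → Fin k → Fin (suc k) → Fin (suc k)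
  adjacentSwap {suc k} zero    zero          = suc zero
  adjacentSwap {suc k} zero    (suc zero)    = zero
  adjacentSwap {suc k} zero    (suc (suc x)) = suc (suc x)
  adjacentSwap {suc k} (suc i) zero          = zero
  adjacentSwap {suc k} (suc i) (suc x)       = suc (adjacentSwap i x)

  adjacentSwap-inject₁ : ∀ {k} (i : Fin k) → adjacentSwap i (inject₁ i) ≡ suc i
  adjacentSwap-inject₁ {suc k} zero    = refl
  adjacentSwap-inject₁ {suc k} (suc i) = cong suc (adjacentSwap-inject₁ i)

  adjacentSwap-suc : ∀ {k} (i : Fin k) → adjacentSwap i (suc i) ≡ inject₁ i
  adjacentSwap-suc {suc k} zero    = refl
  adjacentSwap-suc {suc k} (suc i) = cong suc (adjacentSwap-suc i)

  adjacentSwap-other : ∀ {k} (i : Fin k) l → l ≢ inject₁ i → l ≢ suc i → adjacentSwap i l ≡ l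
  adjacentSwap-other {suc k} zero    zero          l≢i _   = ⊥-elim (l≢i refl)
  adjacentSwap-other {suc k} zero    (suc zero)    _   l≢1 = ⊥-elim (l≢1 refl)
  adjacentSwap-other {suc k} zero    (suc (suc l)) _   _   = refl
  adjacentSwap-other {suc k} (suc i) zero          _   _   = refl
  adjacentSwap-other {suc k} (suc i) (suc l)       l≢i l≢i+1 =
    cong suc (adjacentSwap-other i l (l≢i ∘ cong suc) (l≢i+1 ∘ cong suc))

  adjacentSwap-< : ∀ {k} (i : Fin k) (j : Fin (suc k)) → toℕ j ℕ.< toℕ i → adjacentSwap i j ≡ j
  adjacentSwap-< {suc k} (suc i) zero    _         = refl
  adjacentSwap-< {suc k} (suc i) (suc j) (s≤s j<i) = cong suc (adjacentSwap-< i j j<i)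

  adjacentSwap-punchIn : ∀ {k} (i : Fin (suc k)) l → l ≢ inject₁ i → l ≢ suc i →
                         ∃ λ i′ → ∀ c → adjacentSwap i (punchIn l c) ≡ punchIn l (adjacentSwap i′ c)
  adjacentSwap-punchIn zero zero          l≢i _ = ⊥-elim (l≢i refl)
  adjacentSwap-punchIn zero (suc zero)    _ l≢1 = ⊥-elim (l≢1 refl)
  adjacentSwap-punchIn {suc k} zero (suc (suc l)) _ _ =
    zero , λ { zero → refl ; (suc zero) → refl ; (suc (suc c)) → refl }
  adjacentSwap-punchIn (suc i) zero _ _ = i , λ c → refl
  adjacentSwap-punchIn {suc k} (suc i) (suc l) l≢i l≢i+1
    with adjacentSwap-punchIn i l (l≢i ∘ cong suc) (l≢i+1 ∘ cong suc)
  ... | i′ , commutes = suc i′ , λ { zero → refl ; (suc c) → cong suc (commutes c) }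

  adjacentSwap-punchIn-inject₁ : ∀ {k} (i : Fin k) c →
                                 adjacentSwap i (punchIn (inject₁ i) c) ≡ punchIn (suc i) c
  adjacentSwap-punchIn-inject₁ {suc k} zero    zero    = refl
  adjacentSwap-punchIn-inject₁ {suc k} zero    (suc c) = refl
  adjacentSwap-punchIn-inject₁ {suc k} (suc i) zero    = refl
  adjacentSwap-punchIn-inject₁ {suc k} (suc i) (suc c) = cong suc (adjacentSwap-punchIn-inject₁ i c)

  adjacentSwap-punchIn-suc : ∀ {k} (i : Fin k) c →
                             adjacentSwap i (punchIn (suc i) c) ≡ punchIn (inject₁ i) c
  adjacentSwap-punchIn-suc {suc k} zero    zero    = refl
  adjacentSwap-punchIn-suc {suc k} zero    (suc c) = refl
  adjacentSwap-punchIn-suc {suc k} (suc i) zero    = refl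
  adjacentSwap-punchIn-suc {suc k} (suc i) (suc c) = cong suc (adjacentSwap-punchIn-suc i c)

  sum-adjacentSwap : ∀ {k} (f : Vector R (suc k)) (i : Fin k) → sum (f ∘ adjacentSwap i) ≡ sum f
  sum-adjacentSwap {suc k} f zero = begin
    f (suc zero) + (f zero + s) ≡⟨ sym (+-assoc _ _ s) ⟩
    f (suc zero) + f zero + s   ≡⟨ cong (_+ s) (+-comm _ _) ⟩
    f zero + f (suc zero) + s   ≡⟨ +-assoc _ _ s ⟩
    f zero + (f (suc zero) + s) ∎
    where
    open ≡-Reasoning
    s = sum (λ c → f (suc (suc c)))
  sum-adjacentSwap {suc k} f (suc i) = cong (f zero +_) (sum-adjacentSwap (f ∘ suc) i)

  sign-inject₁ : ∀ {n} (i : Fin n) → sign R (toℕ (inject₁ i)) ≡ sign R (toℕ i)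
  sign-inject₁ i = cong (sign R) (Fin.toℕ-inject₁ i)

  cofactor-adjacentSwap : ∀ {n} (A : Rows n (suc n)) (i : Fin n) l →
                          cofactor (A ∘cols adjacentSwap i) l ≡ - cofactor A (adjacentSwap i l)
  det-adjacentSwap : ∀ {k} (A : Matrix R (suc k)) (i : Fin k) → det R (A ∘cols adjacentSwap i) ≡ - det R A

  cofactor-adjacentSwap {suc k} A i l with l ≟ inject₁ i | l ≟ suc i
  ... | yes refl | _ = begin
    sign R (toℕ (inject₁ i)) * det R (A ∘cols (adjacentSwap i ∘ punchIn (inject₁ i)))
      ≡⟨ cong₂ _*_ (sign-inject₁ i) (det-cong-cols A (adjacentSwap-punchIn-inject₁ i)) ⟩
    sign R (toℕ i) * det R (A ∘cols punchIn (suc i))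
      ≡⟨ sym (-‿involutive _) ⟩
    - (- (sign R (toℕ i) * det R (A ∘cols punchIn (suc i))))
      ≡⟨ cong -_ (-‿distribˡ-* _ _) ⟩
    - cofactor A (suc i)
      ≡⟨ cong (λ x → - cofactor A x) (sym (adjacentSwap-inject₁ i)) ⟩
    - cofactor A (adjacentSwap i (inject₁ i)) ∎
    where open ≡-Reasoning
  ... | no _ | yes refl = begin
    - sign R (toℕ i) * det R (A ∘cols (adjacentSwap i ∘ punchIn (suc i)))
      ≡⟨ cong (- sign R (toℕ i) *_) (det-cong-cols A (adjacentSwap-punchIn-suc i)) ⟩
    - sign R (toℕ i) * det R (A ∘cols punchIn (inject₁ i))
      ≡⟨ sym (-‿distribˡ-* _ _) ⟩
    - (sign R (toℕ i) * det R (A ∘cols punchIn (inject₁ i)))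
      ≡⟨ cong (λ s → - (s * det R (A ∘cols punchIn (inject₁ i)))) (sym (sign-inject₁ i)) ⟩
    - cofactor A (inject₁ i)
      ≡⟨ cong (λ x → - cofactor A x) (sym (adjacentSwap-suc i)) ⟩
    - cofactor A (adjacentSwap i (suc i)) ∎
    where open ≡-Reasoning
  ... | no l≢i | no l≢i+1 with adjacentSwap-punchIn i l l≢i l≢i+1
  ... | i′ , commutes = begin
    sign R (toℕ l) * det R (A ∘cols (adjacentSwap i ∘ punchIn l))
      ≡⟨ cong (sign R (toℕ l) *_) (det-cong-cols A commutes) ⟩
    sign R (toℕ l) * det R (A ∘cols punchIn l ∘cols adjacentSwap i′)
      ≡⟨ cong (sign R (toℕ l) *_) (det-adjacentSwap (A ∘cols punchIn l) i′) ⟩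
    sign R (toℕ l) * - det R (A ∘cols punchIn l)
      ≡⟨ sym (-‿distribʳ-* _ _) ⟩
    - cofactor A l
      ≡⟨ cong (λ x → - cofactor A x) (sym (adjacentSwap-other i l l≢i l≢i+1)) ⟩
    - cofactor A (adjacentSwap i l) ∎
    where open ≡-Reasoning

  det-adjacentSwap {k} A i = begin
    det R (A ∘cols adjacentSwap i)
      ≡⟨ det-expand (A ∘cols adjacentSwap i) ⟩
    sum (λ l → A zero (adjacentSwap i l) * cofactor (A ∘ suc ∘cols adjacentSwap i) l)
      ≡⟨ sum-cong-≗ (λ l → cong (A zero (adjacentSwap i l) *_) (cofactor-adjacentSwap (A ∘ suc) i l)) ⟩
    sum (λ l → A zero (adjacentSwap i l) * - cofactor (A ∘ suc) (adjacentSwap i l))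
      ≡⟨ sum-cong-≗ (λ l → sym (-‿distribʳ-* (A zero (adjacentSwap i l)) (cofactor (A ∘ suc) (adjacentSwap i l)))) ⟩
    sum (λ l → - term (adjacentSwap i l))
      ≡⟨ sum-neg (term ∘ adjacentSwap i) ⟩
    - sum (term ∘ adjacentSwap i)
      ≡⟨ cong -_ (sum-adjacentSwap term i) ⟩
    - sum term
      ≡⟨ cong -_ (sym (det-expand A)) ⟩
    - det R A ∎
    where
    open ≡-Reasoning
    term : Vector R (suc k)
    term l = A zero l * cofactor (A ∘ suc) l

  AgreeOffCol : ∀ {n m} → Rows n m → Rows n m → Fin m → Set
  AgreeOffCol A C c = ∀ r d → d ≢ c → A r d ≡ C r d

  det-minor-agree : ∀ {n} {A C : Matrix R (suc n)} {c} → AgreeOffCol A C c → det R (minor R A c) ≡ det R (minor R C c)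
  det-minor-agree {c = c} A≈C = det-cong (λ r d → A≈C (suc r) (punchIn c d) (Fin.punchInᵢ≢i c d))

  minor-agreeOffCol : ∀ {n} {A C : Matrix R (suc n)} {c l} → AgreeOffCol A C c → (l≢c : l ≢ c) →
                      AgreeOffCol (minor R A l) (minor R C l) (punchOut l≢c)
  minor-agreeOffCol {l = l} A≈C l≢c r d d≢c′ = A≈C (suc r) (punchIn l d) λ l[d]≡c →
    d≢c′ (Fin.punchIn-injective l d _ (trans l[d]≡c (sym (Fin.punchIn-punchOut l≢c))))

  det-additive-col : ∀ {n} (A B C : Matrix R n) (c : Fin n) → AgreeOffCol A C c → AgreeOffCol B C c →
                     (∀ r → C r c ≡ A r c + B r c) → det R C ≡ det R A + det R B
  det-additive-col {suc n} A B C c A≈C B≈C C≡A+B = begin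
    det R C                         ≡⟨ det-suc C ⟩
    sum (term C)                    ≡⟨ sum-cong-≗ term-additive ⟩
    sum (λ l → term A l + term B l) ≡⟨ ∑-distrib-+ (term A) (term B) ⟩
    sum (term A) + sum (term B)     ≡⟨ sym (cong₂ _+_ (det-suc A) (det-suc B)) ⟩
    det R A + det R B               ∎
    where
    open ≡-Reasoning
    term : Matrix R (suc n) → Fin (suc n) → K
    term M l = sign R (toℕ l) * (M zero l * det R (minor R M l))
    term-additive : ∀ l → term C l ≡ term A l + term B l
    term-additive l with l ≟ c
    ... | yes refl = begin
      s * (C zero l * D)                      ≡⟨ cong (λ x → s * (x * D)) (C≡A+B zero) ⟩
      s * ((A zero l + B zero l) * D)         ≡⟨ cong (s *_) (distribʳ D _ _) ⟩
      s * (A zero l * D + B zero l * D)       ≡⟨ distribˡ s _ _ ⟩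
      s * (A zero l * D) + s * (B zero l * D) ≡⟨ sym (cong₂ (λ x y → s * (A zero l * x) + s * (B zero l * y))
                                                              (det-minor-agree A≈C) (det-minor-agree B≈C)) ⟩
      term A l + term B l                     ∎
      where
      s = sign R (toℕ l)
      D = det R (minor R C l)
    ... | no l≢c = begin
      s * (C zero l * DC)                       ≡⟨ cong (λ x → s * (C zero l * x)) minor-additive ⟩
      s * (C zero l * (DA + DB))                ≡⟨ cong (s *_) (distribˡ _ DA DB) ⟩
      s * (C zero l * DA + C zero l * DB)       ≡⟨ distribˡ s _ _ ⟩
      s * (C zero l * DA) + s * (C zero l * DB) ≡⟨ sym (cong₂ (λ x y → s * (x * DA) + s * (y * DB))
                                                                (A≈C zero l l≢c) (B≈C zero l l≢c)) ⟩
      term A l + term B l                       ∎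
      where
      s = sign R (toℕ l)
      DA = det R (minor R A l)
      DB = det R (minor R B l)
      DC = det R (minor R C l)
      minor-additive : DC ≡ DA + DB
      minor-additive = det-additive-col (minor R A l) (minor R B l) (minor R C l) (punchOut l≢c)
        (minor-agreeOffCol A≈C l≢c) (minor-agreeOffCol B≈C l≢c)
        (λ r → subst (λ x → C (suc r) x ≡ A (suc r) x + B (suc r) x) (sym (Fin.punchIn-punchOut l≢c)) (C≡A+B (suc r)))

  punchIn-inject₁≡punchIn-suc : ∀ {n} (i d : Fin n) → d ≢ i → punchIn (inject₁ i) d ≡ punchIn (suc i) d
  punchIn-inject₁≡punchIn-suc zero    zero    d≢i = ⊥-elim (d≢i refl)
  punchIn-inject₁≡punchIn-suc zero    (suc d) _   = refl
  punchIn-inject₁≡punchIn-suc (suc i) zero    _   = refl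
  punchIn-inject₁≡punchIn-suc (suc i) (suc d) d≢i = cong suc (punchIn-inject₁≡punchIn-suc i d (d≢i ∘ cong suc))

  punchIn-inject₁-self : ∀ {n} (i : Fin n) → punchIn (inject₁ i) i ≡ suc i
  punchIn-inject₁-self zero    = refl
  punchIn-inject₁-self (suc i) = cong suc (punchIn-inject₁-self i)

  punchIn-suc-self : ∀ {n} (i : Fin n) → punchIn (suc i) i ≡ inject₁ i
  punchIn-suc-self zero    = refl
  punchIn-suc-self (suc i) = cong suc (punchIn-suc-self i)

  mergeAdjacent : ∀ {n} → Vector R (suc n) → Fin n → Vector R n
  mergeAdjacent v i d with d ≟ i
  ... | yes _ = v (inject₁ i) + v (suc i)
  ... | no _  = v (punchIn (suc i) d)

  mergeAdjacent-self : ∀ {n} (v : Vector R (suc n)) i → mergeAdjacent v i i ≡ v (inject₁ i) + v (suc i)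
  mergeAdjacent-self v i with i ≟ i
  ... | yes _  = refl
  ... | no i≢i = ⊥-elim (i≢i refl)

  mergeAdjacent-other : ∀ {n} (v : Vector R (suc n)) i d → d ≢ i → mergeAdjacent v i d ≡ v (punchIn (suc i) d)
  mergeAdjacent-other v i d d≢i with d ≟ i
  ... | yes d≡i = ⊥-elim (d≢i d≡i)
  ... | no _    = refl

  -- The two minors agree off column i, and adjacent cofactors carry opposite signs.
  cofactor-adjacent-difference : ∀ {n} (A : Rows n (suc n)) (i : Fin n) →
    cofactor A (inject₁ i) + - cofactor A (suc i) ≡ sign R (toℕ i) * det R (λ r → mergeAdjacent (A r) i)
  cofactor-adjacent-difference A i = begin
    sign R (toℕ (inject₁ i)) * det R A₁ + - (- s * det R A₂)
      ≡⟨ cong₂ (λ x y → x * det R A₁ + y) (sign-inject₁ i)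
           (trans (cong -_ (sym (-‿distribˡ-* s (det R A₂)))) (-‿involutive _)) ⟩
    s * det R A₁ + s * det R A₂ ≡⟨ sym (distribˡ s _ _) ⟩
    s * (det R A₁ + det R A₂)   ≡⟨ cong (s *_) (sym merged-additive) ⟩
    s * det R merged            ∎
    where
    open ≡-Reasoning
    s = sign R (toℕ i)
    A₁ A₂ merged : Matrix R _
    A₁ = A ∘cols punchIn (inject₁ i)
    A₂ = A ∘cols punchIn (suc i)
    merged r = mergeAdjacent (A r) i
    merged-additive : det R merged ≡ det R A₁ + det R A₂
    merged-additive = det-additive-col A₁ A₂ merged i
      (λ r d d≢i → trans (cong (A r) (punchIn-inject₁≡punchIn-suc i d d≢i)) (sym (mergeAdjacent-other (A r) i d d≢i)))
      (λ r d d≢i → sym (mergeAdjacent-other (A r) i d d≢i))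
      (λ r → trans (mergeAdjacent-self (A r) i) (trans (+-comm _ _)
        (cong₂ _+_ (cong (A r) (sym (punchIn-inject₁-self i))) (cong (A r) (sym (punchIn-suc-self i))))))

  -- Rows of bounded positive and negative mass, and the determinant bound

  mass : (K → K) → ∀ {m} → Vector R m → K
  mass φ v = sum (φ ∘ v)

  record MassBounded {m} (v : Vector R m) (c : K) : Set where
    constructor massBounded
    field
      ⁺-mass≤ : mass _⁺ v ≤ c
      ⁻-mass≤ : mass _⁻ v ≤ c

  MassBounded⇒0≤ : ∀ {m} {v : Vector R m} {c} → MassBounded v c → 0# ≤ c
  MassBounded⇒0≤ {v = v} (massBounded ⁺-mass≤c _) = ≤-trans (sum-nonneg (⁺-nonneg ∘ v)) ⁺-mass≤c

  MassBounded-mono : ∀ {m m′} {v : Vector R m} {w : Vector R m′} {c} →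
                     mass _⁺ w ≤ mass _⁺ v → mass _⁻ w ≤ mass _⁻ v → MassBounded v c → MassBounded w c
  MassBounded-mono ⁺≤ ⁻≤ (massBounded ⁺-mass≤c ⁻-mass≤c) = massBounded (≤-trans ⁺≤ ⁺-mass≤c) (≤-trans ⁻≤ ⁻-mass≤c)

  MassBounded-neg : ∀ {m} {v : Vector R m} {c} → MassBounded v c → MassBounded (λ d → - v d) c
  MassBounded-neg {v = v} (massBounded ⁺-mass≤c ⁻-mass≤c) =
    massBounded ⁻-mass≤c (subst (_≤ _) (sum-cong-≗ (λ d → cong _⁺ (sym (-‿involutive (v d))))) ⁺-mass≤c)

  mass-punchIn-≤ : ∀ {φ} → (∀ x → 0# ≤ φ x) → ∀ {n} (v : Vector R (suc n)) l →
                   mass φ (v ∘ punchIn l) ≤ mass φ v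
  mass-punchIn-≤ {φ} 0≤φ v l =
    subst₂ _≤_ (+-identityˡ _) (sym (sum-remove (φ ∘ v))) (+-monoˡ-≤ (mass φ (v ∘ punchIn l)) (0≤φ (v l)))

  mass-mergeAdjacent-≤ : ∀ {φ} → (∀ x y → φ (x + y) ≤ φ x + φ y) → ∀ {n} (v : Vector R (suc n)) i →
                         mass φ (mergeAdjacent v i) ≤ mass φ v
  mass-mergeAdjacent-≤ {φ} φ-subadditive {suc n} v i =
    subst₂ _≤_ (sym merged-mass) (sym original-mass) (+-monoˡ-≤ rest (φ-subadditive a b))
    where
    open ≡-Reasoning
    a = v (inject₁ i)
    b = v (suc i)
    rest = sum (φ ∘ v ∘ punchIn (suc i) ∘ punchIn i)
    merged-mass : mass φ (mergeAdjacent v i) ≡ φ (a + b) + rest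
    merged-mass = begin
      mass φ (mergeAdjacent v i)
        ≡⟨ sum-remove {i = i} (φ ∘ mergeAdjacent v i) ⟩
      φ (mergeAdjacent v i i) + sum (φ ∘ mergeAdjacent v i ∘ punchIn i)
        ≡⟨ cong₂ _+_ (cong φ (mergeAdjacent-self v i))
             (sum-cong-≗ (λ d → cong φ (mergeAdjacent-other v i (punchIn i d) (Fin.punchInᵢ≢i i d)))) ⟩
      φ (a + b) + rest ∎
    original-mass : mass φ v ≡ (φ a + φ b) + rest
    original-mass = begin
      mass φ v
        ≡⟨ sum-remove {i = suc i} (φ ∘ v) ⟩
      φ b + sum (φ ∘ v ∘ punchIn (suc i))
        ≡⟨ cong (φ b +_) (sum-remove {i = i} (φ ∘ v ∘ punchIn (suc i))) ⟩
      φ b + (φ (v (punchIn (suc i) i)) + rest)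
        ≡⟨ cong (λ x → φ b + (φ (v x) + rest)) (punchIn-suc-self i) ⟩
      φ b + (φ a + rest)
        ≡⟨ sym (+-assoc _ _ _) ⟩
      φ b + φ a + rest
        ≡⟨ cong (_+ rest) (+-comm _ _) ⟩
      φ a + φ b + rest ∎

  MassBounded-punchIn : ∀ {n} {v : Vector R (suc n)} {c} l → MassBounded v c → MassBounded (v ∘ punchIn l) c
  MassBounded-punchIn {v = v} l =
    MassBounded-mono (mass-punchIn-≤ ⁺-nonneg v l) (mass-punchIn-≤ ⁻-nonneg v l)

  MassBounded-adjacentSwap : ∀ {n} {v : Vector R (suc n)} {c} i → MassBounded v c → MassBounded (v ∘ adjacentSwap i) c
  MassBounded-adjacentSwap {v = v} i =
    MassBounded-mono (reflexive (sum-adjacentSwap (_⁺ ∘ v) i)) (reflexive (sum-adjacentSwap (_⁻ ∘ v) i))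

  MassBounded-mergeAdjacent : ∀ {n} {v : Vector R (suc n)} {c} i → MassBounded v c → MassBounded (mergeAdjacent v i) c
  MassBounded-mergeAdjacent {v = v} i =
    MassBounded-mono (mass-mergeAdjacent-≤ ⁺-subadditive v i) (mass-mergeAdjacent-≤ ⁻-subadditive v i)

  MassBounded-+ : ∀ {n} {v w : Vector R n} {c d} → MassBounded v c → MassBounded w d → MassBounded (λ k → v k + w k) (c + d)
  MassBounded-+ {v = v} {w} (massBounded v⁺≤c v⁻≤c) (massBounded w⁺≤d w⁻≤d) = massBounded
    (≤-trans (sum-mono-≤ (λ k → ⁺-subadditive (v k) (w k)))
      (subst (_≤ _) (sym (∑-distrib-+ (_⁺ ∘ v) (_⁺ ∘ w))) (+-mono-≤ v⁺≤c w⁺≤d)))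
    (≤-trans (sum-mono-≤ (λ k → ⁻-subadditive (v k) (w k)))
      (subst (_≤ _) (sym (∑-distrib-+ (_⁻ ∘ v) (_⁻ ∘ w))) (+-mono-≤ v⁻≤c w⁻≤d)))

  max₀ : ∀ {n} → Vector R n → K
  max₀ = foldr _⊔_ 0#

  ≤-max₀ : ∀ {n} (C : Vector R n) l → C l ≤ max₀ C
  ≤-max₀ C zero    = x≤x⊔y _ _
  ≤-max₀ C (suc l) = ≤-trans (≤-max₀ (C ∘ suc) l) (x≤y⊔x _ _)

  0≤max₀ : ∀ {n} (C : Vector R n) → 0# ≤ max₀ C
  0≤max₀ {zero}  C = ≤-refl
  0≤max₀ {suc n} C = ≤-trans (0≤max₀ (C ∘ suc)) (x≤y⊔x _ _)

  max₀-attained : ∀ {n} (C : Vector R n) → max₀ C ≡ 0# ⊎ ∃ λ j → max₀ C ≡ C j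
  max₀-attained {zero}  C = inj₁ refl
  max₀-attained {suc n} C with ⊔-sel (C zero) (max₀ (C ∘ suc))
  ... | inj₁ max≡C₀ = inj₂ (zero , max≡C₀)
  ... | inj₂ max≡rest with max₀-attained (C ∘ suc)
  ...   | inj₁ rest≡0       = inj₁ (trans max≡rest rest≡0)
  ...   | inj₂ (j , rest≡C) = inj₂ (suc j , trans max≡rest rest≡C)

  max₀+max₀-≤ : ∀ {n} (C : Vector R n) {M} → 0# ≤ M → (∀ l → C l ∈± M) → (∀ j k → C j + - C k ≤ M) →
                max₀ C + max₀ (λ l → - C l) ≤ M
  max₀+max₀-≤ C {M} 0≤M C∈±M C-C≤M with max₀-attained C | max₀-attained (λ l → - C l)
  ... | inj₁ p≡0       | inj₁ q≡0       = subst (_≤ M) (sym (trans (cong₂ _+_ p≡0 q≡0) (+-identityˡ 0#))) 0≤M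
  ... | inj₁ p≡0       | inj₂ (k , q≡Cₖ) = subst (_≤ M) (sym (trans (cong₂ _+_ p≡0 q≡Cₖ) (+-identityˡ _))) (proj₂ (C∈±M k))
  ... | inj₂ (j , p≡Cⱼ) | inj₁ q≡0       = subst (_≤ M) (sym (trans (cong₂ _+_ p≡Cⱼ q≡0) (+-identityʳ _))) (proj₁ (C∈±M j))
  ... | inj₂ (j , p≡Cⱼ) | inj₂ (k , q≡Cₖ) = subst (_≤ M) (sym (cong₂ _+_ p≡Cⱼ q≡Cₖ)) (C-C≤M j k)

  sum-*-≤ : ∀ {n} (a C : Vector R n) {c M} → MassBounded a c → 0# ≤ M →
            (∀ l → C l ∈± M) → (∀ j k → C j + - C k ≤ M) → sum (λ l → a l * C l) ≤ c * M
  sum-*-≤ a C {c} {M} a-bounded 0≤M C∈±M C-C≤M = begin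
    sum (λ l → a l * C l)                             ≤⟨ sum-mono-≤ split-≤ ⟩
    sum (λ l → a l ⁺ * C⁺ + a l ⁻ * C⁻)               ≡⟨ ∑-distrib-+ (λ l → a l ⁺ * C⁺) (λ l → a l ⁻ * C⁻) ⟩
    sum (λ l → a l ⁺ * C⁺) + sum (λ l → a l ⁻ * C⁻)   ≡⟨ sym (cong₂ _+_ (*-distribʳ-sum C⁺ (_⁺ ∘ a)) (*-distribʳ-sum C⁻ (_⁻ ∘ a))) ⟩
    mass _⁺ a * C⁺ + mass _⁻ a * C⁻                   ≤⟨ +-mono-≤ (*-monoˡ-≤ (0≤max₀ C) ⁺-mass≤)
                                                                   (*-monoˡ-≤ (0≤max₀ (λ l → - C l)) ⁻-mass≤) ⟩
    c * C⁺ + c * C⁻                                   ≡⟨ sym (distribˡ c C⁺ C⁻) ⟩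
    c * (C⁺ + C⁻)                                     ≤⟨ *-monoʳ-≤ (MassBounded⇒0≤ a-bounded) (max₀+max₀-≤ C 0≤M C∈±M C-C≤M) ⟩
    c * M                                             ∎
    where
    open ≤-Reasoning
    open MassBounded a-bounded
    C⁺ = max₀ C
    C⁻ = max₀ (λ l → - C l)
    split-≤ : ∀ l → a l * C l ≤ a l ⁺ * C⁺ + a l ⁻ * C⁻
    split-≤ l = subst (_≤ a l ⁺ * C⁺ + a l ⁻ * C⁻) (sym (*-split (a l) (C l)))
      (+-mono-≤ (*-monoʳ-≤ (⁺-nonneg (a l)) (≤-max₀ C l)) (*-monoʳ-≤ (⁻-nonneg (a l)) (≤-max₀ (λ l → - C l) l)))

  sum-*-∈± : ∀ {n} (a C : Vector R n) {c M} → MassBounded a c → 0# ≤ M →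
             (∀ l → C l ∈± M) → (∀ j k → C j + - C k ≤ M) → sum (λ l → a l * C l) ∈± c * M
  sum-*-∈± a C a-bounded 0≤M C∈±M C-C≤M =
    sum-*-≤ a C a-bounded 0≤M C∈±M C-C≤M ,
    subst (_≤ _) -a*C≡-sum (sum-*-≤ (λ l → - a l) C (MassBounded-neg a-bounded) 0≤M C∈±M C-C≤M)
    where
    -a*C≡-sum : sum (λ l → - a l * C l) ≡ - sum (λ l → a l * C l)
    -a*C≡-sum = trans (sum-cong-≗ (λ l → sym (-‿distribˡ-* (a l) (C l)))) (sum-neg (λ l → a l * C l))

  RowsMassBounded : ∀ {n m} → Rows n m → Vector R n → Set
  RowsMassBounded A c = ∀ r → MassBounded (A r) (c r)

  DetBound : ℕ → Set
  DetBound n = ∀ (A : Matrix R n) c → RowsMassBounded A c → det R A ∈± ∏ c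

  module _ {n} (det-bound-n : DetBound n) {c : Vector R n} where

    cofactor-bound : ∀ (A : Rows n (suc n)) → RowsMassBounded A c → ∀ l → cofactor A l ∈± ∏ c
    cofactor-bound A A-bounded l =
      ∈±-sign (toℕ l) (det-bound-n (A ∘cols punchIn l) c (λ r → MassBounded-punchIn l (A-bounded r)))

    cofactor-adjacent-difference-bound : ∀ (A : Rows n (suc n)) → RowsMassBounded A c → ∀ i →
                                         cofactor A (inject₁ i) + - cofactor A (suc i) ∈± ∏ c
    cofactor-adjacent-difference-bound A A-bounded i =
      subst (_∈± ∏ c) (sym (cofactor-adjacent-difference A i))
        (∈±-sign (toℕ i) (det-bound-n _ c (λ r → MassBounded-mergeAdjacent i (A-bounded r))))

    -- Swapping column suc i with its left neighbour negates both cofactors and shortens the distance d.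
    cofactor-difference-bound-+ : ∀ (A : Rows n (suc n)) → RowsMassBounded A c → ∀ d i j →
                                  toℕ j ℕ.+ d ≡ toℕ i → cofactor A j + - cofactor A (suc i) ∈± ∏ c
    cofactor-difference-bound-+ A A-bounded zero i j j+0≡i =
      subst (λ x → cofactor A x + - cofactor A (suc i) ∈± ∏ c) (sym j≡i)
        (cofactor-adjacent-difference-bound A A-bounded i)
      where
      j≡i : j ≡ inject₁ i
      j≡i = Fin.toℕ-injective (trans (trans (sym (ℕ.+-identityʳ (toℕ j))) j+0≡i) (sym (Fin.toℕ-inject₁ i)))
    cofactor-difference-bound-+ A A-bounded (suc d) zero j j+d+1≡0 = ⊥-elim (ℕ.m+1+n≢0 (toℕ j) j+d+1≡0)
    cofactor-difference-bound-+ A A-bounded (suc d) (suc i) j j+d+1≡i+1 =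
      subst (_∈± ∏ c) swapped≡-difference (∈±-neg swapped-bound)
      where
      open ≡-Reasoning
      j+d≡i : toℕ j ℕ.+ d ≡ toℕ (inject₁ i)
      j+d≡i = trans (ℕ.suc-injective (trans (sym (ℕ.+-suc (toℕ j) d)) j+d+1≡i+1)) (sym (Fin.toℕ-inject₁ i))
      j<i+1 : toℕ j ℕ.< toℕ (suc i)
      j<i+1 = s≤s (subst (toℕ j ℕ.≤_) (trans j+d≡i (Fin.toℕ-inject₁ i)) (ℕ.m≤m+n (toℕ j) d))
      A′ = A ∘cols adjacentSwap (suc i)
      swapped-bound : cofactor A′ j + - cofactor A′ (suc (inject₁ i)) ∈± ∏ c
      swapped-bound = cofactor-difference-bound-+ A′ (λ r → MassBounded-adjacentSwap (suc i) (A-bounded r)) d (inject₁ i) j j+d≡i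
      swapped≡-difference : - (cofactor A′ j + - cofactor A′ (suc (inject₁ i))) ≡ cofactor A j + - cofactor A (suc (suc i))
      swapped≡-difference = begin
        - (cofactor A′ j + - cofactor A′ (inject₁ (suc i)))
          ≡⟨ cong₂ (λ x y → - (x + - y)) (cofactor-adjacentSwap A (suc i) j) (cofactor-adjacentSwap A (suc i) (inject₁ (suc i))) ⟩
        - (- cofactor A (adjacentSwap (suc i) j) + - (- cofactor A (adjacentSwap (suc i) (inject₁ (suc i)))))
          ≡⟨ cong₂ (λ x y → - (- cofactor A x + - (- cofactor A y))) (adjacentSwap-< (suc i) j j<i+1) (adjacentSwap-inject₁ (suc i)) ⟩
        - (- cofactor A j + - (- cofactor A (suc (suc i))))
          ≡⟨ cong -_ (-‿+-comm _ _) ⟩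
        - (- (cofactor A j + - cofactor A (suc (suc i))))
          ≡⟨ -‿involutive _ ⟩
        cofactor A j + - cofactor A (suc (suc i)) ∎

    cofactor-difference-bound-< : ∀ (A : Rows n (suc n)) → RowsMassBounded A c → ∀ j k → toℕ j ℕ.< toℕ k →
                                  cofactor A j + - cofactor A k ∈± ∏ c
    cofactor-difference-bound-< A A-bounded j (suc i) (s≤s j≤i) =
      cofactor-difference-bound-+ A A-bounded (toℕ i ∸ toℕ j) i j (ℕ.m+[n∸m]≡n j≤i)

    cofactor-difference-bound : ∀ (A : Rows n (suc n)) → RowsMassBounded A c → ∀ j k →
                                cofactor A j + - cofactor A k ∈± ∏ c
    cofactor-difference-bound A A-bounded j k with ℕ.<-cmp (toℕ j) (toℕ k)
    ... | tri< j<k _ _ = cofactor-difference-bound-< A A-bounded j k j<k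
    ... | tri≈ _ j≡k _ = subst (_∈± ∏ c) (sym C-C≡0) (0∈± (∏-nonneg (λ r → MassBounded⇒0≤ (A-bounded r))))
      where
      C-C≡0 : cofactor A j + - cofactor A k ≡ 0#
      C-C≡0 = trans (cong (λ x → cofactor A j + - cofactor A x) (sym (Fin.toℕ-injective j≡k))) (-‿inverseʳ _)
    ... | tri> _ _ k<j =
      subst (_∈± ∏ c) (⁻¹-anti-homo‿- _ _) (∈±-neg (cofactor-difference-bound-< A A-bounded k j k<j))

  det-bound : ∀ n → DetBound n
  det-bound zero    A c _          = ≤-refl , ≤-trans (0≤x⇒-x≤0 0≤1) 0≤1
  det-bound (suc n) A c A-bounded =
    subst (_∈± ∏ c) (sym (det-expand A))
      (sum-*-∈± (A zero) (cofactor (A ∘ suc)) (A-bounded zero) (∏-nonneg (λ r → MassBounded⇒0≤ (A-bounded (suc r))))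
        (cofactor-bound (det-bound n) (A ∘ suc) (A-bounded ∘ suc))
        (λ j k → proj₁ (cofactor-difference-bound (det-bound n) (A ∘ suc) (A-bounded ∘ suc) j k)))

  -- Rows covered by 𝓕 and by 𝓕 + 𝓕

  Trit : K → Set
  Trit y = y ≡ 0# ⊎ y ≡ 1# ⊎ y ≡ - 1#

  Gapped : K → Set
  Gapped y = y ≡ 0# ⊎ 1# ≤ y ⊎ y ≤ - 1#

  Trit⇒Gapped : ∀ {y} → Trit y → Gapped y
  Trit⇒Gapped (inj₁ y≡0)         = inj₁ y≡0
  Trit⇒Gapped (inj₂ (inj₁ refl)) = inj₂ (inj₁ ≤-refl)
  Trit⇒Gapped (inj₂ (inj₂ refl)) = inj₂ (inj₂ ≤-refl)

  Trit+Trit⇒Gapped : ∀ {y z} → Trit y → Trit z → Gapped (y + z)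
  Trit+Trit⇒Gapped {z = z} (inj₁ refl) z-trit = subst Gapped (sym (+-identityˡ z)) (Trit⇒Gapped z-trit)
  Trit+Trit⇒Gapped (inj₂ (inj₁ refl)) (inj₁ refl)        = inj₂ (inj₁ (reflexive (sym (+-identityʳ 1#))))
  Trit+Trit⇒Gapped (inj₂ (inj₁ refl)) (inj₂ (inj₁ refl)) = inj₂ (inj₁ 1≤2)
  Trit+Trit⇒Gapped (inj₂ (inj₁ refl)) (inj₂ (inj₂ refl)) = inj₁ (-‿inverseʳ 1#)
  Trit+Trit⇒Gapped (inj₂ (inj₂ refl)) (inj₁ refl)        = inj₂ (inj₂ (reflexive (+-identityʳ _)))
  Trit+Trit⇒Gapped (inj₂ (inj₂ refl)) (inj₂ (inj₁ refl)) = inj₁ (-‿inverseˡ 1#)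
  Trit+Trit⇒Gapped (inj₂ (inj₂ refl)) (inj₂ (inj₂ refl)) =
    inj₂ (inj₂ (subst (- 1# + - 1# ≤_) (+-identityʳ (- 1#)) (+-monoʳ-≤ (- 1#) -1≤0)))

  -- A gap around 0 lets the sign condition force x⁺ = 0 when y < 0, without dividing by y.
  ⁺-covered : ∀ {x y} → 0# ≤ x * y → ∣_∣ R x ≤ ∣_∣ R y → Gapped y → x ⁺ ≤ y ⁺
  ⁺-covered {x} 0≤xy ∣x∣≤∣y∣ (inj₁ refl) =
    subst (x ⁺ ≤_) (sym (⁺-nonpos ≤-refl)) (≤-trans (⁺≤∣∣ x) (subst (∣_∣ R x ≤_) (∣∣-nonneg ≤-refl) ∣x∣≤∣y∣))
  ⁺-covered {x} {y} 0≤xy ∣x∣≤∣y∣ (inj₂ (inj₁ 1≤y)) =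
    subst (_ ≤_) (sym (⁺-nonneg-id 0≤y)) (≤-trans (⁺≤∣∣ x) (subst (∣_∣ R x ≤_) (∣∣-nonneg 0≤y) ∣x∣≤∣y∣))
    where
    0≤y : 0# ≤ y
    0≤y = ≤-trans 0≤1 1≤y
  ⁺-covered {x} {y} 0≤xy _ (inj₂ (inj₂ y≤-1)) =
    reflexive (trans (x⁺≡0 (total 0# x)) (sym (⁺-nonpos (≤-trans y≤-1 -1≤0))))
    where
    x⁺≡0 : 0# ≤ x ⊎ x ≤ 0# → x ⁺ ≡ 0#
    x⁺≡0 (inj₂ x≤0) = ⁺-nonpos x≤0
    x⁺≡0 (inj₁ 0≤x) = ⁺-nonpos (0≤-x⇒x≤0 (≤-trans 0≤xy (subst (_ ≤_) x*-1≡-x (*-monoʳ-≤ 0≤x y≤-1))))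
      where
      x*-1≡-x : x * - 1# ≡ - x
      x*-1≡-x = trans (sym (-‿distribʳ-* x 1#)) (cong -_ (*-identityʳ x))

  Gapped-neg : ∀ {y} → Gapped y → Gapped (- y)
  Gapped-neg (inj₁ refl)       = inj₁ -0#≈0#
  Gapped-neg (inj₂ (inj₁ 1≤y)) = inj₂ (inj₂ (-‿antimono-≤ 1≤y))
  Gapped-neg (inj₂ (inj₂ y≤-1)) = inj₂ (inj₁ (subst (_≤ _) (-‿involutive 1#) (-‿antimono-≤ y≤-1)))

  ⁻-covered : ∀ {x y} → 0# ≤ x * y → ∣_∣ R x ≤ ∣_∣ R y → Gapped y → x ⁻ ≤ y ⁻
  ⁻-covered {x} {y} 0≤xy ∣x∣≤∣y∣ y-gapped =
    ⁺-covered (subst (0# ≤_) (sym (-x*-y≡x*y x y)) 0≤xy) (subst₂ _≤_ (sym (∣-x∣≡∣x∣ x)) (sym (∣-x∣≡∣x∣ y)) ∣x∣≤∣y∣)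
      (Gapped-neg y-gapped)

  ⪯-MassBounded : ∀ {n} {x y : Vector R n} {c} → _⪯_ R x y → (∀ k → Gapped (y k)) → MassBounded y c → MassBounded x c
  ⪯-MassBounded x⪯y y-gapped = MassBounded-mono
    (sum-mono-≤ (λ k → ⁺-covered (proj₁ (x⪯y k)) (proj₂ (x⪯y k)) (y-gapped k)))
    (sum-mono-≤ (λ k → ⁻-covered (proj₁ (x⪯y k)) (proj₂ (x⪯y k)) (y-gapped k)))

  e-self : ∀ {n} (i : Fin n) → e R i i ≡ 1#
  e-self i with i ≟ i
  ... | yes _  = refl
  ... | no i≢i = ⊥-elim (i≢i refl)

  e-other : ∀ {n} (i k : Fin n) → k ≢ i → e R i k ≡ 0#
  e-other i k k≢i with k ≟ i
  ... | yes k≡i = ⊥-elim (k≢i k≡i)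
  ... | no _    = refl

  e-01 : ∀ {n} (i k : Fin n) → e R i k ≡ 0# ⊎ e R i k ≡ 1#
  e-01 i k with k ≟ i
  ... | yes _ = inj₂ refl
  ... | no _  = inj₁ refl

  e-nonneg : ∀ {n} (i k : Fin n) → 0# ≤ e R i k
  e-nonneg i k = [ (λ e≡0 → reflexive (sym e≡0)) , (λ e≡1 → subst (0# ≤_) (sym e≡1) 0≤1) ]′ (e-01 i k)

  ⟦⟧-Trit : ∀ {n} (f : FName R n) k → Trit (⟦_⟧ R f k)
  ⟦⟧-Trit (pName i j _) k with e-01 j k | e-01 i k
  ... | inj₁ eⱼ≡0 | inj₁ eᵢ≡0 = inj₁ (trans (cong₂ (λ a b → a + - b) eⱼ≡0 eᵢ≡0) (x-0≡x 0#))
  ... | inj₂ eⱼ≡1 | inj₁ eᵢ≡0 = inj₂ (inj₁ (trans (cong₂ (λ a b → a + - b) eⱼ≡1 eᵢ≡0) (x-0≡x 1#)))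
  ... | inj₁ eⱼ≡0 | inj₂ eᵢ≡1 = inj₂ (inj₂ (trans (cong₂ (λ a b → a + - b) eⱼ≡0 eᵢ≡1) (+-identityˡ _)))
  ... | inj₂ eⱼ≡1 | inj₂ eᵢ≡1 = inj₁ (trans (cong₂ (λ a b → a + - b) eⱼ≡1 eᵢ≡1) (-‿inverseʳ 1#))
  ⟦⟧-Trit (eName i) k = [ inj₁ , inj₂ ∘ inj₁ ]′ (e-01 i k)
  ⟦⟧-Trit (negEName i) k =
    [ (λ e≡0 → inj₁ (trans (cong -_ e≡0) -0#≈0#)) , (λ e≡1 → inj₂ (inj₂ (cong -_ e≡1))) ]′ (e-01 i k)

  ⁺-mass-single : ∀ {n} (v : Vector R (suc n)) l → v l ≡ 1# → (∀ d → v (punchIn l d) ≤ 0#) → mass _⁺ v ≡ 1#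
  ⁺-mass-single v l vₗ≡1 rest≤0 =
    trans (sum-single (_⁺ ∘ v) l (λ d → ⁺-nonpos (rest≤0 d))) (trans (cong _⁺ vₗ≡1) (⁺-nonneg-id 0≤1))

  ⁺-mass-nonpos : ∀ {n} (v : Vector R n) → (∀ k → v k ≤ 0#) → mass _⁺ v ≡ 0#
  ⁺-mass-nonpos {n} v v≤0 = trans (sum-cong-≗ (λ k → ⁺-nonpos (v≤0 k))) (sum-replicate-zero n)

  ⁺-mass-e : ∀ {n} (i : Fin n) → mass _⁺ (e R i) ≡ 1#
  ⁺-mass-e {suc n} i = ⁺-mass-single (e R i) i (e-self i)
    (λ d → reflexive (e-other i (punchIn i d) (Fin.punchInᵢ≢i i d)))

  ⁺-mass-p : ∀ {n} (i j : Fin n) → i ≢ j → mass _⁺ (p R i j) ≡ 1#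
  ⁺-mass-p {suc n} i j i≢j = ⁺-mass-single (p R i j) j
    (trans (cong₂ (λ a b → a + - b) (e-self j) (e-other i j (i≢j ∘ sym))) (x-0≡x 1#))
    (λ d → subst (_≤ 0#) (sym (trans (cong (_+ - e R i (punchIn j d)) (e-other j (punchIn j d) (Fin.punchInᵢ≢i j d)))
                                      (+-identityˡ _)))
                 (0≤x⇒-x≤0 (e-nonneg i (punchIn j d))))

  ⟦⟧-MassBounded : ∀ {n} (f : FName R n) → MassBounded (⟦_⟧ R f) 1#
  ⟦⟧-MassBounded (pName i j i≢j) = massBounded (reflexive (⁺-mass-p i j i≢j))
    (reflexive (trans (sum-cong-≗ (λ k → cong _⁺ (⁻¹-anti-homo‿- (e R j k) (e R i k)))) (⁺-mass-p j i (i≢j ∘ sym))))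
  ⟦⟧-MassBounded (eName i) = massBounded (reflexive (⁺-mass-e i))
    (subst (_≤ 1#) (sym (⁺-mass-nonpos _ (λ k → 0≤x⇒-x≤0 (e-nonneg i k)))) 0≤1)
  ⟦⟧-MassBounded (negEName i) = massBounded (subst (_≤ 1#) (sym (⁺-mass-nonpos _ (λ k → 0≤x⇒-x≤0 (e-nonneg i k)))) 0≤1)
    (reflexive (trans (sum-cong-≗ (λ k → cong _⁺ (-‿involutive (e R i k)))) (⁺-mass-e i)))

  CoveredByF⇒MassBounded : ∀ {n} {x : Vector R n} → CoveredByF R x → MassBounded x 1#
  CoveredByF⇒MassBounded (f , x⪯f) = ⪯-MassBounded x⪯f (Trit⇒Gapped ∘ ⟦⟧-Trit f) (⟦⟧-MassBounded f)

  CoveredByFF⇒MassBounded : ∀ {n} {x : Vector R n} → CoveredByFF R x → MassBounded x (1# + 1#)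
  CoveredByFF⇒MassBounded (f , g , x⪯f+g) = ⪯-MassBounded x⪯f+g (λ k → Trit+Trit⇒Gapped (⟦⟧-Trit f k) (⟦⟧-Trit g k))
    (MassBounded-+ (⟦⟧-MassBounded f) (⟦⟧-MassBounded g))

  shiftRows : ∀ {m n} (rows : Fin m → Fin (suc n)) → (∀ k → zero ≢ rows k) → Fin m → Fin n
  shiftRows rows 0∉rows k = punchOut (0∉rows k)

  suc-shiftRows : ∀ {m n} (rows : Fin m → Fin (suc n)) 0∉rows k → suc (shiftRows rows 0∉rows k) ≡ rows k
  suc-shiftRows rows 0∉rows k = Fin.punchIn-punchOut (0∉rows k)

  shiftRows-injective : ∀ {m n} {rows : Fin m → Fin (suc n)} 0∉rows →
                        Injective _≡_ _≡_ rows → Injective _≡_ _≡_ (shiftRows rows 0∉rows)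
  shiftRows-injective 0∉rows rows-injective eq = rows-injective (Fin.punchOut-injective (0∉rows _) (0∉rows _) eq)

  ∏-≤-pow2 : ∀ n m (rows : Fin m → Fin n) → Injective _≡_ _≡_ rows → (c : Vector R n) →
             (∀ i → 0# ≤ c i) → (∀ i → c i ≤ 1# + 1#) → (∀ k → c (rows k) ≤ 1#) → ∏ c ≤ pow2 R (n ∸ m)
  ∏-≤-pow2 zero    zero    _    _ _ _ _ _ = ≤-refl
  ∏-≤-pow2 zero    (suc m) rows _ _ _ _ _ with rows zero
  ... | ()
  ∏-≤-pow2 (suc n) m rows rows-injective c 0≤c c≤2 c-rows≤1 with Fin.any? (λ k → rows k ≟ zero)
  ∏-≤-pow2 (suc n) zero rows _ _ _ _ _ | yes (() , _)
  ∏-≤-pow2 (suc n) (suc m) rows rows-injective c 0≤c c≤2 c-rows≤1 | yes (k₀ , rows-k₀≡0) =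
    subst (_ ≤_) (*-identityˡ _) (*-mono-≤ (0≤c zero) c₀≤1 (∏-nonneg (0≤c ∘ suc)) rest-≤)
    where
    other-rows = rows ∘ punchIn k₀
    0∉other-rows : ∀ k → zero ≢ other-rows k
    0∉other-rows k 0≡rows-k = Fin.punchInᵢ≢i k₀ k (rows-injective (trans (sym 0≡rows-k) (sym rows-k₀≡0)))
    c₀≤1 : c zero ≤ 1#
    c₀≤1 = subst (λ i → c i ≤ 1#) rows-k₀≡0 (c-rows≤1 k₀)
    rest-≤ : ∏ (c ∘ suc) ≤ pow2 R (n ∸ m)
    rest-≤ = ∏-≤-pow2 n m (shiftRows other-rows 0∉other-rows)
      (shiftRows-injective 0∉other-rows (Fin.punchIn-injective k₀ _ _ ∘ rows-injective))
      (c ∘ suc) (0≤c ∘ suc) (c≤2 ∘ suc)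
      (λ k → subst (λ i → c i ≤ 1#) (sym (suc-shiftRows other-rows 0∉other-rows k)) (c-rows≤1 (punchIn k₀ k)))
  ∏-≤-pow2 (suc n) m rows rows-injective c 0≤c c≤2 c-rows≤1 | no 0∉rows′ =
    subst (_ ≤_) (cong (pow2 R) (sym suc-n∸m)) (*-mono-≤ (0≤c zero) (c≤2 zero) (∏-nonneg (0≤c ∘ suc)) rest-≤)
    where
    0∉rows : ∀ k → zero ≢ rows k
    0∉rows k 0≡rows-k = 0∉rows′ (k , sym 0≡rows-k)
    shifted-injective : Injective _≡_ _≡_ (shiftRows rows 0∉rows)
    shifted-injective = shiftRows-injective 0∉rows rows-injective
    rest-≤ : ∏ (c ∘ suc) ≤ pow2 R (n ∸ m)
    rest-≤ = ∏-≤-pow2 n m (shiftRows rows 0∉rows) shifted-injective (c ∘ suc) (0≤c ∘ suc) (c≤2 ∘ suc)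
      (λ k → subst (λ i → c i ≤ 1#) (sym (suc-shiftRows rows 0∉rows k)) (c-rows≤1 k))
    suc-n∸m : suc n ∸ m ≡ suc (n ∸ m)
    suc-n∸m = ℕ.+-∸-assoc 1 (Fin.injective⇒≤ shifted-injective)

  det-bound-covered : ∀ {n} (A : Matrix R n) → (∀ i → CoveredByFF R (A i)) →
                      ∀ {m} (rows : Fin m → Fin n) → Injective _≡_ _≡_ rows → (∀ k → CoveredByF R (A (rows k))) →
                      ∣_∣ R (det R A) ≤ pow2 R (n ∸ m)
  det-bound-covered {n} A A-coveredFF {m} rows rows-injective A-rows-coveredF =
    ≤-trans (∈±⇒∣∣≤ (det-bound n A weight (λ i → bounded-at i (rowOf i))))
            (∏-≤-pow2 n m rows rows-injective weight (λ i → 0≤weight (rowOf i)) (λ i → weight≤2 (rowOf i))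
              (λ k → weight-row≤1 k (rowOf (rows k))))
    where
    weightOf : ∀ {P : Set} → Dec P → K
    weightOf (yes _) = 1#
    weightOf (no _)  = 1# + 1#
    rowOf : ∀ i → Dec (∃ λ k → rows k ≡ i)
    rowOf i = Fin.any? (λ k → rows k ≟ i)
    weight : Vector R n
    weight i = weightOf (rowOf i)
    bounded-at : ∀ i (i∈rows? : Dec (∃ λ k → rows k ≡ i)) → MassBounded (A i) (weightOf i∈rows?)
    bounded-at i (yes (k , rows-k≡i)) = subst (λ j → MassBounded (A j) 1#) rows-k≡i (CoveredByF⇒MassBounded (A-rows-coveredF k))
    bounded-at i (no _)              = CoveredByFF⇒MassBounded (A-coveredFF i)
    0≤weight : ∀ {P : Set} (P? : Dec P) → 0# ≤ weightOf P?
    0≤weight (yes _) = 0≤1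
    0≤weight (no _)  = ≤-trans 0≤1 1≤2
    weight≤2 : ∀ {P : Set} (P? : Dec P) → weightOf P? ≤ 1# + 1#
    weight≤2 (yes _) = 1≤2
    weight≤2 (no _)  = ≤-refl
    weight-row≤1 : ∀ k (P? : Dec (∃ λ k′ → rows k′ ≡ rows k)) → weightOf P? ≤ 1#
    weight-row≤1 k (yes _)    = ≤-refl
    weight-row≤1 k (no k∉rows) = ⊥-elim (k∉rows (k , refl))

mainTheorem8 : (R : RealField) → (n : ℕ) → (A : Matrix R n) →
  (∀ i → CoveredByFF R (A i)) →
  (RealField._≤_ R (∣_∣ R (det R A)) (pow2 R n)) ×
  ((m : ℕ) → (rows : Fin m → Fin n) → Injective _≡_ _≡_ rows →
    (∀ k → CoveredByF R (A (rows k))) →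
    RealField._≤_ R (∣_∣ R (det R A)) (pow2 R (n ∸ m)))
mainTheorem8 R n A A-coveredFF =
  det-bound-covered A A-coveredFF {0} (λ ()) (λ {}) (λ ()) ,
  λ m → det-bound-covered A A-coveredFF
  where open DeterminantBound R
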